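{- Let $D$ be a locatable digraph of order $n$ with $\gamma_{OL}(D)=n$. If a vertex of $D$ is not domination-forced, then it is location-forced; and if a vertex of $D$ is not location-forced, then it is domination-forced.
   Context: Digraphs are finite and may contain loops; for each ordered pair $(x,y)$ there is at most one arc $xy$. $N^-(v)$ is the set of vertices $u$ such that $uv$ is an arc (including $v$ if $v$ has a loop). An OLD set of $D$ is a set $S\subseteq V(D)$ such that every vertex has an in-neighbour in $S$ and for every two distinct vertices $u,v$, some vertex of $S$ lies in $N^-(u)\ominus N^-(v)$ (symmetric difference). $D$ is locatable if it admits an OLD set, and then $\gamma_{OL}(D)$ is the minimum size of an OLD set. A vertex $v$ is domination-forced if some vertex $w$ has $N^-(w)=\{v\}$; location-forced if there are distinct vertices $x,y$ with $N^-(x)\ominus N^-(y)=\{v\}$. -}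

module Defs where

open import Data.Nat using (ℕ; _≤_)
open import Data.Bool using (Bool; true)
open import Data.Fin using (Fin)
open import Data.Fin.Subset using (Subset; _∈_; ∣_∣)
open import Data.Product using (Σ; ∃; ∃-syntax; _×_)
open import Relation.Binary.PropositionalEquality using (_≡_; _≢_)
open import Function.Bundles using (_⇔_)

-- A digraph of order n on vertex set Fin n, given by its arc relation:
-- Arc u v ≡ true iff uv is an arc.  Loops (Arc v v ≡ true) are allowed,
-- and there is at most one arc per ordered pair.
record Digraph (n : ℕ) : Set where
  field
    Arc : Fin n → Fin n → Bool

open Digraph public

InNbr : ∀ {n} → Digraph n → Fin n → Fin n → Set
InNbr D u v = Arc D u v ≡ true

InSymDiff : ∀ {n} → Digraph n → Fin n → Fin n → Fin n → Set
InSymDiff D u x y = Arc D u x ≢ Arc D u y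

IsOLD : ∀ {n} → Digraph n → Subset n → Set
IsOLD {n} D S =
  (∀ (v : Fin n) → ∃[ u ] (u ∈ S × InNbr D u v)) ×
  (∀ (x y : Fin n) → x ≢ y → ∃[ s ] (s ∈ S × InSymDiff D s x y))

Locatable : ∀ {n} → Digraph n → Set
Locatable {n} D = ∃[ S ] IsOLD D S

γOL≡ : ∀ {n} → Digraph n → ℕ → Set
γOL≡ {n} D k =
  (∃[ S ] (IsOLD D S × ∣ S ∣ ≡ k)) ×
  (∀ (S : Subset n) → IsOLD D S → k ≤ ∣ S ∣)

DominationForced : ∀ {n} → Digraph n → Fin n → Set
DominationForced {n} D v = ∃[ w ] (∀ (u : Fin n) → InNbr D u w ⇔ u ≡ v)

LocationForced : ∀ {n} → Digraph n → Fin n → Set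
LocationForced {n} D v =
  ∃[ x ] ∃[ y ] (x ≢ y × (∀ (u : Fin n) → InSymDiff D u x y ⇔ u ≡ v))

-- Since γ_OL(D) = n, no set of n − 1 vertices is OLD. But if v were neither
-- domination-forced nor location-forced, then V ∖ {v} would be OLD: every set
-- N⁻(w) and every N⁻(x) ⊖ N⁻(y) with x ≠ y is non-empty (D is locatable) and
-- different from {v}, so it meets V ∖ {v}. Both forcing properties are decidable,
-- so the resulting double negations can be removed.
module Submission where

open import Defs
open import Data.Nat using (ℕ; _<_)
open import Data.Nat.Properties using (<-irrefl; ≤-<-trans)
open import Data.Bool using (true)
open import Data.Bool.Properties using () renaming (_≟_ to _≟ᵇ_)
open import Data.Fin using (Fin; _≟_)
open import Data.Fin.Properties using (any?; all?)
open import Data.Fin.Subset using (⊤; _-_; _∈_; ∣_∣)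
open import Data.Fin.Subset.Properties using (∈⊤; ∣⊤∣≡n; x∈p∧x≢y⇒x∈p-y; x∈p⇒∣p-x∣<∣p∣)
open import Data.Product using (_×_; _,_; ∃; ∃-syntax; proj₂; map₂; uncurry)
open import Function using (_∘_)
open import Function.Bundles using (_⇔_; mk⇔; Equivalence)
open import Relation.Nullary using (¬_; Dec; yes; no)
open import Relation.Nullary.Decidable using (_×-dec_; _→-dec_; ¬?; map′; decidable-stable)
open import Relation.Unary using (Pred; Decidable)
open import Relation.Binary.PropositionalEquality using (_≡_; _≢_; refl; subst)
open import Data.Empty using (⊥; ⊥-elim)

_⇔-dec_ : ∀ {a b} {A : Set a} {B : Set b} → Dec A → Dec B → Dec (A ⇔ B)
a? ⇔-dec b? = map′ (uncurry mk⇔) (λ e → to e , from e) ((a? →-dec b?) ×-dec (b? →-dec a?))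
  where open Equivalence

IsSingleton : ∀ {n ℓ} → Pred (Fin n) ℓ → Fin n → Set ℓ
IsSingleton P v = ∀ u → P u ⇔ u ≡ v

isSingleton? : ∀ {n ℓ} {P : Pred (Fin n) ℓ} → Decidable P → Decidable (IsSingleton P)
isSingleton? P? v = all? (λ u → P? u ⇔-dec (u ≟ v))

satisfiable∧¬singleton⇒∃≢ : ∀ {n ℓ} {P : Pred (Fin n) ℓ} → Decidable P →
  ∀ v → ∃ P → ¬ IsSingleton P v → ∃[ u ] (u ≢ v × P u)
satisfiable∧¬singleton⇒∃≢ {P = P} P? v (t , Pt) ¬single
  with any? (λ u → ¬? (u ≟ v) ×-dec P? u)
... | yes witness = witness
... | no none = ⊥-elim (¬single λ u → mk⇔ (only u) λ { refl → subst P (only t Pt) Pt })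
  where
  only : ∀ u → P u → u ≡ v
  only u Pu with u ≟ v
  ... | yes u≡v = u≡v
  ... | no u≢v = ⊥-elim (none (u , u≢v , Pu))

module _ {n : ℕ} (D : Digraph n) where

  inNbr? : ∀ w → Decidable (λ u → InNbr D u w)
  inNbr? w u = Arc D u w ≟ᵇ true

  inSymDiff? : ∀ x y → Decidable (λ u → InSymDiff D u x y)
  inSymDiff? x y u = ¬? (Arc D u x ≟ᵇ Arc D u y)

  dominationForced? : Decidable (DominationForced D)
  dominationForced? v = any? (λ w → isSingleton? (inNbr? w) v)

  locationForced? : Decidable (LocationForced D)
  locationForced? v =
    any? (λ x → any? (λ y → ¬? (x ≟ y) ×-dec isSingleton? (inSymDiff? x y) v))

  unforced⇒⊤-v-IsOLD : Locatable D → ∀ v →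
    ¬ DominationForced D v → ¬ LocationForced D v → IsOLD D (⊤ - v)
  unforced⇒⊤-v-IsOLD (_ , dominates , locates) v ¬df ¬lf = dominates′ , locates′
    where
    dominates′ : ∀ w → ∃[ u ] (u ∈ ⊤ - v × InNbr D u w)
    dominates′ w with satisfiable∧¬singleton⇒∃≢ (inNbr? w) v
                        (map₂ proj₂ (dominates w)) (¬df ∘ (w ,_))
    ... | u , u≢v , uw = u , x∈p∧x≢y⇒x∈p-y ∈⊤ u≢v , uw

    locates′ : ∀ x y → x ≢ y → ∃[ u ] (u ∈ ⊤ - v × InSymDiff D u x y)
    locates′ x y x≢y with satisfiable∧¬singleton⇒∃≢ (inSymDiff? x y) v
                            (map₂ proj₂ (locates x y x≢y)) (λ single → ¬lf (x , y , x≢y , single))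
    ... | u , u≢v , u∈⊖ = u , x∈p∧x≢y⇒x∈p-y ∈⊤ u≢v , u∈⊖

  γOL≡n⇒¬unforced : Locatable D → γOL≡ D n → ∀ v →
    ¬ DominationForced D v → ¬ LocationForced D v → ⊥
  γOL≡n⇒¬unforced locatable (_ , minimal) v ¬df ¬lf =
    <-irrefl refl (≤-<-trans (minimal (⊤ - v) ⊤-v-IsOLD) ∣⊤-v∣<n)
    where
    ⊤-v-IsOLD : IsOLD D (⊤ - v)
    ⊤-v-IsOLD = unforced⇒⊤-v-IsOLD locatable v ¬df ¬lf

    ∣⊤-v∣<n : ∣ ⊤ - v ∣ < n
    ∣⊤-v∣<n = subst (∣ ⊤ - v ∣ <_) (∣⊤∣≡n n) (x∈p⇒∣p-x∣<∣p∣ {x = v} {p = ⊤} ∈⊤)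

corollary2p3 : ∀ {n : ℕ} (D : Digraph n) → Locatable D → γOL≡ D n →
    (∀ (v : Fin n) → ¬ DominationForced D v → LocationForced D v) ×
    (∀ (v : Fin n) → ¬ LocationForced D v → DominationForced D v)
corollary2p3 D locatable γ≡n =
  (λ v ¬df → decidable-stable (locationForced? D v) (unforced v ¬df)) ,
  (λ v ¬lf → decidable-stable (dominationForced? D v) (λ ¬df → unforced v ¬df ¬lf))
  where
  unforced : ∀ v → ¬ DominationForced D v → ¬ LocationForced D v → ⊥
  unforced = γOL≡n⇒¬unforced D locatable γ≡n
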